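{- For any sorting network with $n$ inputs, depth $d\in\{1,2\}$ and arity $k$, we have $k=n$.
   Context: A network with $n$ inputs and depth $d$ consists of $d+1$ arrays of cells $c_{a,b}$ ($0\le a\le d$, $1\le b\le n$) and $d$ layers of comparators; layer $a$ ($1\le a\le d$) is a partition of $\{1,\dots,n\}$ into sets called comparators. Given integer values in the input cells $c_{0,1},\dots,c_{0,n}$, for each comparator $I$ of layer $a$ the values in cells $c_{a-1,i}$, $i\in I$, are sorted in non-decreasing order and written into the cells $c_{a,i}$, $i\in I$, in increasing order of $i$; this inductively defines all cell values. The arity of the network is the maximum size of a comparator over all layers. The network is sorting if for every integer input the output array $c_{d,1},\dots,c_{d,n}$ is non-decreasing. -}

module Defs where

open import Data.Nat using (ℕ; zero; suc; _⊔_)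
open import Data.Integer using (ℤ; 0ℤ; _≤_)
import Data.Integer.Properties as ℤP
open import Data.Fin using (Fin; _<?_)
import Data.Fin as F
open import Data.Fin.Properties using () renaming (_≟_ to _≟ᶠ_)
open import Data.List using (List; []; _∷_; filter; map; length; foldr; allFin)
open import Data.Vec using (Vec)
import Data.Vec as V
open import Data.List.Sort.MergeSort ℤP.≤-decTotalOrder using (sort)

-- A layer of comparators on n cells: a partition of {1..n} (here Fin n),
-- encoded by a labelling function; the comparators are the nonempty fibres
-- {j | L j ≡ L i}.  Every partition arises this way (and vice versa).
Layer : ℕ → Set
Layer n = Fin n → Fin n

Network : ℕ → ℕ → Set
Network n d = Vec (Layer n) d

Cells : ℕ → Set
Cells n = Fin n → ℤ

comparatorOf : ∀ {n} → Layer n → Fin n → List (Fin n)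
comparatorOf {n} L i = filter (λ j → L j ≟ᶠ L i) (allFin n)

rankIn : ∀ {n} → Layer n → Fin n → ℕ
rankIn L i = length (filter (λ j → j <? i) (comparatorOf L i))

-- r-th element of a list (0-based), with a default that is never used.
nth : List ℤ → ℕ → ℤ
nth []       _       = 0ℤ
nth (x ∷ xs) zero    = x
nth (x ∷ xs) (suc r) = nth xs r

-- Applying one layer: in each comparator, sort the values and write them
-- back in increasing order of index.
applyLayer : ∀ {n} → Layer n → Cells n → Cells n
applyLayer L c i = nth (sort (map c (comparatorOf L i))) (rankIn L i)

run : ∀ {n d} → Network n d → Cells n → Cells n
run V.[]       c = c
run (L V.∷ Ls) c = run Ls (applyLayer L c)

IsSorting : ∀ {n d} → Network n d → Set
IsSorting {n} N = (c : Cells n) (i j : Fin n) → i F.≤ j → run N c i ≤ run N c j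

layerArity : ∀ {n} → Layer n → ℕ
layerArity {n} L = foldr (λ i m → length (comparatorOf L i) ⊔ m) 0 (allFin n)

arity : ∀ {n d} → Network n d → ℕ
arity V.[]       = 0
arity (L V.∷ Ls) = layerArity L ⊔ arity Ls

-- Every layer preserves the number of ones of a 0-1 input. At depth one, the indicator of the
-- comparator of 0 is left unchanged by the layer, so sortedness forces that comparator to be everything.
-- At depth two, suppose the last layer Q is not a single comparator; let p be the first index outside
-- Q's comparator of 0 and V the 0-1 array with ones exactly from p on, so Q's comparator of p lies at
-- or above p. Deleting a one of V at x ≥ p leaves a zero at p in the output, which Q takes from a
-- zero at some z after the first layer P. Every zero t of that input lies in P's comparator of z:
-- otherwise raising t back to one restores the number of ones of V, whose only sorted arrangement is
-- V itself, yet the zero at z would still reach Q's comparator of p. Varying x, all indices end up in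
-- one comparator of P.
module Submission where

open import Defs
open import Data.Nat using (ℕ)
open import Data.Sum using (_⊎_)
open import Relation.Binary.PropositionalEquality using (_≡_)

open import Data.Nat as ℕ using (zero; suc; _+_; _⊔_; z≤n; s≤s)
import Data.Nat.Properties as ℕP
open import Data.Nat.ListAction using (sum)
open import Data.Nat.ListAction.Properties using (sum-↭)
open import Algebra.Properties.CommutativeMonoid.Sum ℕP.+-0-commutativeMonoid
  using (sum-syntax; sum-cong-≗; sum-replicate-zero; ∑-comm)
open import Algebra.Properties.CommutativeSemigroup ℕP.+-commutativeSemigroup using (x∙yz≈y∙xz)
open import Data.Integer as ℤ using (ℤ; 0ℤ; 1ℤ; ∣_∣; +≤+)
import Data.Integer.Properties as ℤP
open import Data.Fin as F using (Fin; _<?_)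
import Data.Fin.Properties as FP
open import Data.Fin.Properties using () renaming (_≟_ to _≟ᶠ_)
open import Data.Bool using (if_then_else_; true; false)
open import Data.List using (List; []; _∷_; filter; map; length; foldr; allFin; tabulate)
import Data.List.Properties as LP
open import Data.List.Relation.Unary.All as All using (All; []; _∷_)
open import Data.List.Relation.Unary.Any using (here; there)
open import Data.List.Relation.Unary.AllPairs using (AllPairs; []; _∷_)
import Data.List.Relation.Unary.AllPairs.Properties as AllPairsP
open import Data.List.Membership.Propositional using (_∈_)
import Data.List.Membership.Propositional.Properties as ∈P
open import Data.List.Relation.Binary.Permutation.Propositional using (_↭_; ↭-sym)
import Data.List.Relation.Binary.Permutation.Propositional.Properties as ↭P
open import Data.List.Sort.MergeSort ℤP.≤-decTotalOrder using (sort)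
open import Data.List.Sort.MergeSort.Properties ℤP.≤-decTotalOrder using (sort-↭)
import Data.Vec as V
open import Data.Vec.Relation.Unary.Any as VAny using (here; there)
open import Data.Vec.Functional using (updateAt)
open import Data.Vec.Functional.Properties using (updateAt-updates; updateAt-minimal)
open import Data.Product using (∃; _×_; _,_; proj₁; proj₂)
open import Data.Sum using (inj₁; inj₂)
open import Data.Empty using (⊥; ⊥-elim)
open import Relation.Nullary using (¬_; Dec; yes; no; does)
open import Relation.Unary using (Pred; Decidable)
open import Relation.Binary.PropositionalEquality
  using (refl; sym; trans; cong; cong₂; subst; subst₂; _≢_; _≗_; module ≡-Reasoning)
open import Function using (_∘_)

sum-tabulate : ∀ {n} (h : Fin n → ℕ) → sum (tabulate h) ≡ ∑[ y < n ] h y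
sum-tabulate {zero}  h = refl
sum-tabulate {suc n} h = cong (h F.zero +_) (sum-tabulate (h ∘ F.suc))

sum-map-allFin : ∀ {n} (h : Fin n → ℕ) → sum (map h (allFin n)) ≡ ∑[ y < n ] h y
sum-map-allFin h = trans (cong sum (LP.map-tabulate (λ y → y) h)) (sum-tabulate h)

sum-map-filter : ∀ {a p} {A : Set a} {P : Pred A p} (P? : Decidable P) (g : A → ℕ) xs →
  sum (map g (filter P? xs)) ≡ sum (map (λ x → if does (P? x) then g x else 0) xs)
sum-map-filter P? g [] = refl
sum-map-filter P? g (x ∷ xs) with does (P? x)
... | true  = cong (g x +_) (sum-map-filter P? g xs)
... | false = sum-map-filter P? g xs

∑-pointMass : ∀ {k} (a : Fin k) (v : ℕ) → ∑[ ℓ < k ] (if does (a ≟ᶠ ℓ) then v else 0) ≡ v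
∑-pointMass {suc k} F.zero    v = trans (cong (v +_) (sum-replicate-zero k)) (ℕP.+-identityʳ v)
∑-pointMass {suc k} (F.suc a) v = ∑-pointMass a v

∑-fibres : ∀ {n k} (L : Fin n → Fin k) (g : Fin n → ℕ) →
  ∑[ y < n ] g y ≡ ∑[ ℓ < k ] sum (map g (filter (λ y → L y ≟ᶠ ℓ) (allFin n)))
∑-fibres {n} {k} L g = begin
  ∑[ y < n ] g y                    ≡⟨ sum-cong-≗ (λ y → sym (∑-pointMass (L y) (g y))) ⟩
  ∑[ y < n ] ∑[ ℓ < k ] δ y ℓ       ≡⟨ ∑-comm δ ⟩
  ∑[ ℓ < k ] ∑[ y < n ] δ y ℓ       ≡⟨ sum-cong-≗ fibre ⟨
  ∑[ ℓ < k ] sum (map g (filter (λ y → L y ≟ᶠ ℓ) (allFin n))) ∎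
  where
  open ≡-Reasoning
  δ : Fin n → Fin k → ℕ
  δ y ℓ = if does (L y ≟ᶠ ℓ) then g y else 0
  fibre : ∀ ℓ → sum (map g (filter (λ y → L y ≟ᶠ ℓ) (allFin n))) ≡ ∑[ y < n ] δ y ℓ
  fibre ℓ = trans (sum-map-filter (λ y → L y ≟ᶠ ℓ) g (allFin n)) (sum-map-allFin (λ y → δ y ℓ))

∑-mono-≤ : ∀ {n} {f g : Fin n → ℕ} → (∀ y → f y ℕ.≤ g y) → ∑[ y < n ] f y ℕ.≤ ∑[ y < n ] g y
∑-mono-≤ {zero}  f≤g = z≤n
∑-mono-≤ {suc n} f≤g = ℕP.+-mono-≤ (f≤g F.zero) (∑-mono-≤ (f≤g ∘ F.suc))

∑-mono-< : ∀ {n} {f g : Fin n → ℕ} → (∀ y → f y ℕ.≤ g y) → ∀ x → f x ℕ.< g x →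
  ∑[ y < n ] f y ℕ.< ∑[ y < n ] g y
∑-mono-< {suc n} f≤g F.zero    fx<gx = ℕP.+-mono-<-≤ fx<gx (∑-mono-≤ (f≤g ∘ F.suc))
∑-mono-< {suc n} f≤g (F.suc x) fx<gx = ℕP.+-mono-≤-< (f≤g F.zero) (∑-mono-< (f≤g ∘ F.suc) x fx<gx)

block : ∀ {n} → Layer n → Fin n → List (Fin n)
block {n} L ℓ = filter (λ j → L j ≟ᶠ ℓ) (allFin n)

rank : ∀ {n} → List (Fin n) → Fin n → ℕ
rank xs i = length (filter (λ j → j <? i) xs)

module _ {n : ℕ} (L : Layer n) where

  ∈-block⁺ : ∀ {ℓ j} → L j ≡ ℓ → j ∈ block L ℓ
  ∈-block⁺ {ℓ} {j} = ∈P.∈-filter⁺ (λ j → L j ≟ᶠ ℓ) (∈P.∈-allFin j)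

  ∈-block⁻ : ∀ {ℓ j} → j ∈ block L ℓ → L j ≡ ℓ
  ∈-block⁻ {ℓ} j∈ = proj₂ (∈P.∈-filter⁻ (λ j → L j ≟ᶠ ℓ) {xs = allFin n} j∈)

  block-increasing : ∀ ℓ → AllPairs F._<_ (block L ℓ)
  block-increasing ℓ = AllPairsP.filter⁺ (λ j → L j ≟ᶠ ℓ) (AllPairsP.tabulate⁺-< (λ i<j → i<j))

map-nth-rank : ∀ {n} (xs : List (Fin n)) → AllPairs F._<_ xs →
  (ys : List ℤ) → length ys ≡ length xs → map (λ x → nth ys (rank xs x)) xs ≡ ys
map-nth-rank []      _            []       _  = refl
map-nth-rank (x ∷ xs) (x<xs ∷ inc) (y ∷ ys) eq = cong₂ _∷_ head-rank tail-rank
  where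
  rank-head : rank (x ∷ xs) x ≡ 0
  rank-head = cong length (trans (LP.filter-reject (λ j → j <? x) (FP.<-irrefl refl))
                                 (LP.filter-none (λ j → j <? x) (All.map (λ x<z z<x → FP.<-asym x<z z<x) x<xs)))
  head-rank : nth (y ∷ ys) (rank (x ∷ xs) x) ≡ y
  head-rank = cong (nth (y ∷ ys)) rank-head
  rank-tail : ∀ {z} → x F.< z → rank (x ∷ xs) z ≡ suc (rank xs z)
  rank-tail {z} x<z = cong length (LP.filter-accept (λ j → j <? z) x<z)
  tail-rank : map (λ z → nth (y ∷ ys) (rank (x ∷ xs) z)) xs ≡ ys
  tail-rank = trans (LP.map-cong-local (All.map (cong (nth (y ∷ ys)) ∘ rank-tail) x<xs))
                    (map-nth-rank xs inc ys (ℕP.suc-injective eq))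

module _ {n : ℕ} (L : Layer n) (c : Cells n) where

  applyLayer-block : ∀ {ℓ j} → j ∈ block L ℓ →
    applyLayer L c j ≡ nth (sort (map c (block L ℓ))) (rank (block L ℓ) j)
  applyLayer-block {j = j} j∈ =
    cong (λ ℓ → nth (sort (map c (block L ℓ))) (rank (block L ℓ) j)) (∈-block⁻ L j∈)

  map-applyLayer-block : ∀ ℓ → map (applyLayer L c) (block L ℓ) ≡ sort (map c (block L ℓ))
  map-applyLayer-block ℓ =
    trans (LP.map-cong-local (All.tabulate applyLayer-block))
          (map-nth-rank (block L ℓ) (block-increasing L ℓ) _
            (trans (↭P.↭-length (sort-↭ (map c (block L ℓ)))) (LP.length-map c (block L ℓ))))

  applyLayer-↭ : ∀ ℓ → map (applyLayer L c) (block L ℓ) ↭ map c (block L ℓ)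
  applyLayer-↭ ℓ = subst (_↭ map c (block L ℓ)) (sym (map-applyLayer-block ℓ)) (sort-↭ _)

  applyLayer-source : ∀ i → ∃ λ j → L j ≡ L i × applyLayer L c i ≡ c j
  applyLayer-source i
    with ∈P.∈-map⁻ c (↭P.∈-resp-↭ (applyLayer-↭ (L i)) (∈P.∈-map⁺ (applyLayer L c) (∈-block⁺ L refl)))
  ... | j , j∈ , eq = j , ∈-block⁻ L j∈ , eq

  applyLayer-target : ∀ {ℓ} j → L j ≡ ℓ → ∃ λ y → L y ≡ ℓ × applyLayer L c y ≡ c j
  applyLayer-target {ℓ} j Lj
    with ∈P.∈-map⁻ (applyLayer L c) (↭P.∈-resp-↭ (↭-sym (applyLayer-↭ ℓ)) (∈P.∈-map⁺ c (∈-block⁺ L Lj)))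
  ... | y , y∈ , eq = y , ∈-block⁻ L y∈ , sym eq

  applyLayer-preserves : ∀ {p} (B : ℤ → Set p) → (∀ y → B (c y)) → ∀ y → B (applyLayer L c y)
  applyLayer-preserves B Bc y with applyLayer-source y
  ... | j , _ , eq = subst B (sym eq) (Bc j)

  applyLayer-blockConstant : (∀ i j → L i ≡ L j → c i ≡ c j) → applyLayer L c ≗ c
  applyLayer-blockConstant const i with applyLayer-source i
  ... | j , Lj , eq = trans eq (const j i Lj)

applyLayer-local : ∀ {n} (L : Layer n) (c c′ : Cells n) i →
  (∀ j → L j ≡ L i → c j ≡ c′ j) → applyLayer L c i ≡ applyLayer L c′ i
applyLayer-local L c c′ i agree =
  cong (λ xs → nth (sort xs) (rankIn L i)) (LP.map-cong-local (All.tabulate (λ j∈ → agree _ (∈-block⁻ L j∈))))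

-- Conservation of mass

mass : ∀ {n} → Cells n → ℕ
mass {n} c = ∑[ y < n ] ∣ c y ∣

mass-applyLayer : ∀ {n} (L : Layer n) (c : Cells n) → mass (applyLayer L c) ≡ mass c
mass-applyLayer {n} L c = begin
  mass (applyLayer L c)                               ≡⟨ ∑-fibres L (∣_∣ ∘ applyLayer L c) ⟩
  ∑[ ℓ < n ] sum (map (∣_∣ ∘ applyLayer L c) (block L ℓ)) ≡⟨ sum-cong-≗ blockwise ⟩
  ∑[ ℓ < n ] sum (map (∣_∣ ∘ c) (block L ℓ))          ≡⟨ ∑-fibres L (∣_∣ ∘ c) ⟨
  mass c                                              ∎
  where
  open ≡-Reasoning
  blockwise : ∀ ℓ → sum (map (∣_∣ ∘ applyLayer L c) (block L ℓ)) ≡ sum (map (∣_∣ ∘ c) (block L ℓ))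
  blockwise ℓ = trans (cong sum (LP.map-∘ (block L ℓ)))
                  (trans (sum-↭ (↭P.map⁺ ∣_∣ (applyLayer-↭ L c ℓ))) (cong sum (sym (LP.map-∘ (block L ℓ)))))

mass-run : ∀ {n d} (N : Network n d) (c : Cells n) → mass (run N c) ≡ mass c
mass-run V.[]       c = refl
mass-run (L V.∷ N) c = trans (mass-run N (applyLayer L c)) (mass-applyLayer L c)

run-preserves : ∀ {n d p} (N : Network n d) (B : ℤ → Set p) (c : Cells n) →
  (∀ y → B (c y)) → ∀ y → B (run N c y)
run-preserves V.[]       B c Bc = Bc
run-preserves (L V.∷ N) B c Bc = run-preserves N B (applyLayer L c) (applyLayer-preserves L c B Bc)

mass-updateAt : ∀ {n} (c : Cells n) i v → ∣ c i ∣ + mass (updateAt c i (λ _ → v)) ≡ ∣ v ∣ + mass c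
mass-updateAt {suc n} c F.zero    v = x∙yz≈y∙xz ∣ c F.zero ∣ ∣ v ∣ (mass (c ∘ F.suc))
mass-updateAt {suc n} c (F.suc i) v = begin
  ∣ c (F.suc i) ∣ + (∣ c F.zero ∣ + mass (updateAt (c ∘ F.suc) i (λ _ → v)))
    ≡⟨ x∙yz≈y∙xz ∣ c (F.suc i) ∣ ∣ c F.zero ∣ _ ⟩
  ∣ c F.zero ∣ + (∣ c (F.suc i) ∣ + mass (updateAt (c ∘ F.suc) i (λ _ → v)))
    ≡⟨ cong (∣ c F.zero ∣ +_) (mass-updateAt (c ∘ F.suc) i v) ⟩
  ∣ c F.zero ∣ + (∣ v ∣ + mass (c ∘ F.suc))
    ≡⟨ x∙yz≈y∙xz ∣ c F.zero ∣ ∣ v ∣ _ ⟩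
  ∣ v ∣ + mass c ∎
  where open ≡-Reasoning

Bit : ℤ → Set
Bit v = v ≡ 0ℤ ⊎ v ≡ 1ℤ

Binary : ∀ {n} → Cells n → Set
Binary c = ∀ y → Bit (c y)

Sorted : ∀ {n} → Cells n → Set
Sorted c = ∀ i j → i F.≤ j → c i ℤ.≤ c j

bit : ∀ {a} {A : Set a} → Dec A → ℤ
bit (yes _) = 1ℤ
bit (no _)  = 0ℤ

bit-yes : ∀ {a} {A : Set a} (a? : Dec A) → A → bit a? ≡ 1ℤ
bit-yes (yes _) _ = refl
bit-yes (no ¬a) a = ⊥-elim (¬a a)

bit-no : ∀ {a} {A : Set a} (a? : Dec A) → ¬ A → bit a? ≡ 0ℤ
bit-no (yes a) ¬a = ⊥-elim (¬a a)
bit-no (no _)  _  = refl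

Bit-bit : ∀ {a} {A : Set a} (a? : Dec A) → Bit (bit a?)
Bit-bit (yes _) = inj₂ refl
Bit-bit (no _)  = inj₁ refl

Bit-≤0 : ∀ {v} → Bit v → v ℤ.≤ 0ℤ → v ≡ 0ℤ
Bit-≤0 (inj₁ v≡0)  _        = v≡0
Bit-≤0 (inj₂ refl) (+≤+ ())

Bit-≥1 : ∀ {v} → Bit v → 1ℤ ℤ.≤ v → v ≡ 1ℤ
Bit-≥1 (inj₁ refl) (+≤+ ())
Bit-≥1 (inj₂ v≡1)  _        = v≡1

∣Bit∣≤1 : ∀ {v} → Bit v → ∣ v ∣ ℕ.≤ 1
∣Bit∣≤1 (inj₁ refl) = z≤n
∣Bit∣≤1 (inj₂ refl) = s≤s z≤n

Binary-updateAt : ∀ {n} {c : Cells n} {v} → Binary c → Bit v → ∀ i → Binary (updateAt c i (λ _ → v))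
Binary-updateAt {c = c} binary bit-v i y with y ≟ᶠ i
... | yes refl = subst Bit (sym (updateAt-updates i c)) bit-v
... | no y≢i   = subst Bit (sym (updateAt-minimal y i c y≢i)) (binary y)

threshold : ∀ {n} → Fin n → Cells n
threshold p y = bit (p FP.≤? y)

module _ {n : ℕ} (p : Fin n) where

  threshold-≥ : ∀ {y} → p F.≤ y → threshold p y ≡ 1ℤ
  threshold-≥ {y} = bit-yes (p FP.≤? y)

  threshold-< : ∀ {y} → ¬ p F.≤ y → threshold p y ≡ 0ℤ
  threshold-< {y} = bit-no (p FP.≤? y)

module _ {n : ℕ} {f : Cells n} (sorted : Sorted f) (binary : Binary f) where

  sorted-zero-below : ∀ {y w} → f y ≡ 0ℤ → w F.≤ y → f w ≡ 0ℤ
  sorted-zero-below {y} {w} fy≡0 w≤y = Bit-≤0 (binary w) (subst (f w ℤ.≤_) fy≡0 (sorted w y w≤y))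

  sorted-one-above : ∀ {y w} → f y ≡ 1ℤ → y F.≤ w → f w ≡ 1ℤ
  sorted-one-above {y} {w} fy≡1 y≤w = Bit-≥1 (binary w) (subst (ℤ._≤ f w) fy≡1 (sorted y w y≤w))

  mass-threshold-≤ : ∀ {p} → f p ≡ 1ℤ → mass (threshold p) ℕ.≤ mass f
  mass-threshold-≤ {p} fp≡1 = ∑-mono-≤ pointwise
    where
    pointwise : ∀ w → ∣ threshold p w ∣ ℕ.≤ ∣ f w ∣
    pointwise w with p FP.≤? w
    ... | yes p≤w rewrite sorted-one-above fp≡1 p≤w = ℕP.≤-refl
    ... | no _    = z≤n

  mass-<-threshold : ∀ {p} → f p ≡ 0ℤ → mass f ℕ.< mass (threshold p)
  mass-<-threshold {p} fp≡0 = ∑-mono-< pointwise p at-p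
    where
    pointwise : ∀ w → ∣ f w ∣ ℕ.≤ ∣ threshold p w ∣
    pointwise w with p FP.≤? w
    ... | yes _   = ∣Bit∣≤1 (binary w)
    ... | no p≰w  rewrite sorted-zero-below fp≡0 (ℕP.<⇒≤ (ℕP.≰⇒> p≰w)) = z≤n
    at-p : ∣ f p ∣ ℕ.< ∣ threshold p p ∣
    at-p rewrite fp≡0 | threshold-≥ p (FP.≤-refl {x = p}) = s≤s z≤n

module _ {n : ℕ} (g : Fin n → ℕ) where

  foldr-⊔-lub : ∀ {b} xs → (∀ x → g x ℕ.≤ b) → foldr (λ i m → g i ⊔ m) 0 xs ℕ.≤ b
  foldr-⊔-lub []       _   = z≤n
  foldr-⊔-lub (x ∷ xs) g≤b = ℕP.⊔-lub (g≤b x) (foldr-⊔-lub xs g≤b)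

  foldr-⊔-upper : ∀ {x} xs → x ∈ xs → g x ℕ.≤ foldr (λ i m → g i ⊔ m) 0 xs
  foldr-⊔-upper (x ∷ xs) (here refl) = ℕP.m≤m⊔n (g x) _
  foldr-⊔-upper (y ∷ xs) (there x∈)  = ℕP.m≤n⇒m≤o⊔n (g y) (foldr-⊔-upper xs x∈)

length-block-≤ : ∀ {n} (L : Layer n) ℓ → length (block L ℓ) ℕ.≤ n
length-block-≤ {n} L ℓ = ℕP.≤-trans (LP.length-filter (λ j → L j ≟ᶠ ℓ) (allFin n))
                                     (ℕP.≤-reflexive (LP.length-tabulate (λ j → j)))

arity-≤ : ∀ {n d} (N : Network n d) → arity N ℕ.≤ n
arity-≤ V.[]                = z≤n
arity-≤ {n} (L V.∷ N) =
  ℕP.⊔-lub (foldr-⊔-lub (length ∘ comparatorOf L) (allFin n) (λ i → length-block-≤ L (L i))) (arity-≤ N)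

Full : ∀ {m} → Layer (suc m) → Set
Full L = ∀ j → L j ≡ L F.zero

layerArity-Full : ∀ {m} (L : Layer (suc m)) → Full L → suc m ℕ.≤ layerArity L
layerArity-Full {m} L full = begin
  suc m                              ≡⟨ LP.length-tabulate (λ j → j) ⟨
  length (allFin (suc m))            ≡⟨ cong length (LP.filter-all (λ j → L j ≟ᶠ L F.zero) (All.universal full _)) ⟨
  length (comparatorOf L F.zero)     ≤⟨ foldr-⊔-upper (length ∘ comparatorOf L) (allFin (suc m)) (∈P.∈-allFin F.zero) ⟩
  layerArity L                       ∎
  where open ℕP.≤-Reasoning

arity-Full : ∀ {m d} (N : Network (suc m) d) → VAny.Any Full N → suc m ℕ.≤ arity N
arity-Full (L V.∷ N) (here full) = ℕP.≤-trans (layerArity-Full L full) (ℕP.m≤m⊔n (layerArity L) (arity N))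
arity-Full (L V.∷ N) (there any) = ℕP.≤-trans (arity-Full N any) (ℕP.m≤n⊔m (layerArity L) (arity N))

-- Depth one

depth1-Full : ∀ {m} (L : Layer (suc m)) → IsSorting (L V.∷ V.[]) → Full L
depth1-Full {m} L sorting j with L j ≟ᶠ L F.zero
... | yes Lj≡L0 = Lj≡L0
... | no Lj≢L0  = ⊥-elim (1≰0 (subst₂ ℤ._≤_ (output-zero) (output-j) (sorting c F.zero j z≤n)))
  where
  c : Cells (suc m)
  c y = bit (L y ≟ᶠ L F.zero)
  output : applyLayer L c ≗ c
  output = applyLayer-blockConstant L c (λ i k Li≡Lk → cong (λ ℓ → bit (ℓ ≟ᶠ L F.zero)) Li≡Lk)
  output-zero : applyLayer L c F.zero ≡ 1ℤ
  output-zero = trans (output F.zero) (bit-yes (L F.zero ≟ᶠ L F.zero) refl)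
  output-j : applyLayer L c j ≡ 0ℤ
  output-j = trans (output j) (bit-no (L j ≟ᶠ L F.zero) Lj≢L0)
  1≰0 : ¬ (1ℤ ℤ.≤ 0ℤ)
  1≰0 (+≤+ ())

-- Depth two

module Depth2 {m : ℕ} (P Q : Layer (suc m)) (sorting : IsSorting (P V.∷ Q V.∷ V.[]))
  (p : Fin (suc m)) (Qp≢Q0 : Q p ≢ Q F.zero) (below-p : ∀ y → y F.< p → Q y ≡ Q F.zero) where

  V : Cells (suc m)
  V = threshold p

  p≰0 : ¬ p F.≤ F.zero {m}
  p≰0 p≤0 = Qp≢Q0 (cong Q (FP.toℕ-injective (ℕP.n≤0⇒n≡0 p≤0)))

  block-p-above : ∀ {y} → Q y ≡ Q p → p F.≤ y
  block-p-above {y} Qy≡Qp with p FP.≤? y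
  ... | yes p≤y = p≤y
  ... | no p≰y  = ⊥-elim (Qp≢Q0 (trans (sym Qy≡Qp) (below-p y (ℕP.≰⇒> p≰y))))

  -- Opaque so that comparing outputs never makes the typechecker unfold the mergesort.
  opaque
    out : Cells (suc m) → Cells (suc m)
    out = run (P V.∷ Q V.∷ V.[])

    out-applyLayer : ∀ c → out c ≗ applyLayer Q (applyLayer P c)
    out-applyLayer c y = refl

    sorted-out : ∀ c → Sorted (out c)
    sorted-out = sorting

    binary-out : ∀ c → Binary c → Binary (out c)
    binary-out c binary = run-preserves (P V.∷ Q V.∷ V.[]) Bit c binary

    mass-out : ∀ c → mass (out c) ≡ mass c
    mass-out = mass-run (P V.∷ Q V.∷ V.[])

  balanced-no-zero : ∀ c → Binary c → mass c ≡ mass V → ∀ y → Q y ≡ Q p → out c y ≢ 0ℤ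
  balanced-no-zero c binary balanced y Qy≡Qp out-y≡0 =
    ℕP.<-irrefl (trans (mass-out c) balanced)
      (mass-<-threshold (sorted-out c) (binary-out c binary)
        (sorted-zero-below (sorted-out c) (binary-out c binary) out-y≡0 (block-p-above Qy≡Qp)))

  deficient-zero-at-p : ∀ c → Binary c → mass c ℕ.< mass V → out c p ≡ 0ℤ
  deficient-zero-at-p c binary deficient with binary-out c binary p
  ... | inj₁ out-p≡0 = out-p≡0
  ... | inj₂ out-p≡1 = ⊥-elim (ℕP.<⇒≱ deficient
    (subst (mass V ℕ.≤_) (mass-out c) (mass-threshold-≤ (sorted-out c) (binary-out c binary) out-p≡1)))

  module OneDeleted (x : Fin (suc m)) (p≤x : p F.≤ x) where

    c : Cells (suc m)
    c = updateAt V x (λ _ → 0ℤ)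

    binary : Binary c
    binary = Binary-updateAt (λ y → Bit-bit (p FP.≤? y)) (inj₁ refl) x

    mass-c : suc (mass c) ≡ mass V
    mass-c = subst (λ v → ∣ v ∣ + mass c ≡ mass V) (threshold-≥ p p≤x) (mass-updateAt V x 0ℤ)

    zero-at-x : c x ≡ 0ℤ
    zero-at-x = updateAt-updates x V

    zero-below-p : ∀ w → ¬ p F.≤ w → c w ≡ 0ℤ
    zero-below-p w p≰w with w ≟ᶠ x
    ... | yes refl = zero-at-x
    ... | no w≢x   = trans (updateAt-minimal w x V w≢x) (threshold-< p p≰w)

    z : Fin (suc m)
    z = proj₁ (applyLayer-source Q (applyLayer P c) p)

    Qz≡Qp : Q z ≡ Q p
    Qz≡Qp = proj₁ (proj₂ (applyLayer-source Q (applyLayer P c) p))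

    Pc-z≡0 : applyLayer P c z ≡ 0ℤ
    Pc-z≡0 = begin
      applyLayer P c z                 ≡⟨ proj₂ (proj₂ (applyLayer-source Q (applyLayer P c) p)) ⟨
      applyLayer Q (applyLayer P c) p  ≡⟨ out-applyLayer c p ⟨
      out c p                          ≡⟨ deficient-zero-at-p c binary (ℕP.≤-reflexive mass-c) ⟩
      0ℤ                               ∎
      where open ≡-Reasoning

    zeros-in-block-z : ∀ t → c t ≡ 0ℤ → P t ≡ P z
    zeros-in-block-z t ct≡0 with P t ≟ᶠ P z
    ... | yes Pt≡Pz = Pt≡Pz
    ... | no Pt≢Pz  = ⊥-elim (zero-reaches-block-p (applyLayer-target Q (applyLayer P c′) z Qz≡Qp))
      where
      c′ : Cells (suc m)
      c′ = updateAt c t (λ _ → 1ℤ)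
      balanced : mass c′ ≡ mass V
      balanced = trans (subst (λ v → ∣ v ∣ + mass c′ ≡ suc (mass c)) ct≡0 (mass-updateAt c t 1ℤ)) mass-c
      Pc′-z≡0 : applyLayer P c′ z ≡ 0ℤ
      Pc′-z≡0 = trans (applyLayer-local P c′ c z
                        (λ j Pj≡Pz → updateAt-minimal j t c (λ j≡t → Pt≢Pz (trans (cong P (sym j≡t)) Pj≡Pz))))
                      Pc-z≡0
      zero-reaches-block-p : (∃ λ y → Q y ≡ Q p × applyLayer Q (applyLayer P c′) y ≡ applyLayer P c′ z) → ⊥
      zero-reaches-block-p (y , Qy≡Qp , out-y≡Pc′z) =
        balanced-no-zero c′ (Binary-updateAt binary (inj₂ refl) t) balanced y Qy≡Qp
          (trans (out-applyLayer c′ y) (trans out-y≡Pc′z Pc′-z≡0))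

  full-P : Full P
  full-P w with p FP.≤? w
  ... | yes p≤w = trans (D.zeros-in-block-z w D.zero-at-x)
                        (sym (D.zeros-in-block-z F.zero (D.zero-below-p F.zero p≰0)))
    where module D = OneDeleted w p≤w
  ... | no p≰w  = trans (D.zeros-in-block-z w (D.zero-below-p w p≰w))
                        (sym (D.zeros-in-block-z F.zero (D.zero-below-p F.zero p≰0)))
    where module D = OneDeleted p FP.≤-refl

depth2-Full : ∀ {m} (P Q : Layer (suc m)) → IsSorting (P V.∷ Q V.∷ V.[]) → Full P ⊎ Full Q
depth2-Full {m} P Q sorting with FP.all? (λ j → Q j ≟ᶠ Q F.zero)
... | yes full-Q = inj₂ full-Q
... | no ¬full-Q with FP.¬∀⟶∃¬-smallest (suc m) _ (λ j → Q j ≟ᶠ Q F.zero) ¬full-Q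
... | p , Qp≢Q0 , before-p = inj₁ (Depth2.full-P P Q sorting p Qp≢Q0 below-p)
  where
  below-p : ∀ y → y F.< p → Q y ≡ Q F.zero
  below-p y y<p = subst (λ w → Q w ≡ Q F.zero)
    (FP.toℕ-injective (trans (FP.toℕ-inject (F.fromℕ< y<p)) (FP.toℕ-fromℕ< y<p)))
    (before-p (F.fromℕ< y<p))

shallow-sorting-Full : ∀ {m d} → d ≡ 1 ⊎ d ≡ 2 → (N : Network (suc m) d) → IsSorting N → VAny.Any Full N
shallow-sorting-Full (inj₁ refl) (L V.∷ V.[]) sorting = here (depth1-Full L sorting)
shallow-sorting-Full (inj₂ refl) (P V.∷ Q V.∷ V.[]) sorting with depth2-Full P Q sorting
... | inj₁ full-P = here full-P
... | inj₂ full-Q = there (here full-Q)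

mainTheorem4 : (n d k : ℕ) → d ≡ 1 ⊎ d ≡ 2 → (N : Network n d) →
    IsSorting N → arity N ≡ k → k ≡ n
mainTheorem4 zero    d _ _  N _       refl = ℕP.n≤0⇒n≡0 (arity-≤ N)
mainTheorem4 (suc m) d _ shallow N sorting refl =
  ℕP.≤-antisym (arity-≤ N) (arity-Full N (shallow-sorting-Full shallow N sorting))
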